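{- Over intuitionistic logic, the following are equivalent: (i) for every set $S$ and every reduction $\mathcal{J}$ on $S$, $\mathbb{J}(\mathbb{A}(\mathcal{J}))=\mathcal{J}$; (ii) the law of excluded middle.
   Context: The ambient framework is intuitionistic (impredicative) set theory. An operator on $S$ is a map $\mathrm{Pow}(S)\to\mathrm{Pow}(S)$, ordered pointwise by inclusion. For $U,V\subseteq S$, $U\between V$ means there exists $a\in U\cap V$. $\mathcal{O}\triangleleft\mathcal{O}'$ means: for all $U,V\subseteq S$, $\mathcal{O}(U)\between\mathcal{O}'(V)$ implies $U\between\mathcal{O}'(V)$. A saturation is a monotone idempotent operator $\mathcal{A}$ with $U\subseteq\mathcal{A}(U)$ for all $U$; a reduction is a monotone idempotent operator $\mathcal{J}$ with $\mathcal{J}(U)\subseteq U$ for all $U$. For a reduction $\mathcal{J}$, $\mathbb{A}(\mathcal{J})$ is the greatest saturation $\mathcal{A}$ with $\mathcal{A}\triangleleft\mathcal{J}$; for a saturation $\mathcal{A}$, $\mathbb{J}(\mathcal{A})$ is the greatest reduction $\mathcal{J}$ with $\mathcal{A}\triangleleft\mathcal{J}$ (both always exist). -}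

module Defs where

open import Level using (Level; suc; _⊔_) renaming (zero to lzero)
open import Data.Product using (Σ; _×_; _,_; ∃)
open import Data.Sum using (_⊎_)
open import Relation.Nullary using (¬_)

Pow : Set → Set₁
Pow S = S → Set

module _ {S : Set} where

  _∈_ : S → Pow S → Set
  a ∈ U = U a

  _⊆_ : Pow S → Pow S → Set
  U ⊆ V = ∀ a → a ∈ U → a ∈ V

  _≬_ : Pow S → Pow S → Set
  U ≬ V = Σ S (λ a → a ∈ U × a ∈ V)

Op : Set → Set₁
Op S = Pow S → Pow S

module _ {S : Set} where

  _≤ₒ_ : Op S → Op S → Set₁
  O ≤ₒ O' = ∀ U → O U ⊆ O' U

  _≐_ : Op S → Op S → Set₁
  O ≐ O' = (O ≤ₒ O') × (O' ≤ₒ O)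

  Monotone : Op S → Set₁
  Monotone O = ∀ U V → U ⊆ V → O U ⊆ O V

  Idempotent : Op S → Set₁
  Idempotent O = ∀ U → (O (O U) ⊆ O U) × (O U ⊆ O (O U))

  IsSaturation : Op S → Set₁
  IsSaturation A = Monotone A × Idempotent A × (∀ U → U ⊆ A U)

  IsReduction : Op S → Set₁
  IsReduction J = Monotone J × Idempotent J × (∀ U → J U ⊆ U)

  _◁_ : Op S → Op S → Set₁
  O ◁ O' = ∀ U V → O U ≬ O' V → U ≬ O' V

  Is𝔸 : Op S → Op S → Set₁
  Is𝔸 J A = IsSaturation A × (A ◁ J)
          × (∀ A' → IsSaturation A' → A' ◁ J → A' ≤ₒ A)

  Is𝕁 : Op S → Op S → Set₁
  Is𝕁 A J = IsReduction J × (A ◁ J)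
          × (∀ J' → IsReduction J' → A ◁ J' → J' ≤ₒ J)

StatementI : Set₁
StatementI = ∀ (S : Set) (J : Op S) → IsReduction J →
             ∀ (A : Op S) → Is𝔸 J A →
             ∀ (J' : Op S) → Is𝕁 A J' → J' ≐ J

LEM : Set₁
LEM = ∀ (P : Set) → P ⊎ ¬ P

-- Classically 𝔸(J) is the dual ∁ ∘ J ∘ ∁ of J, and if a point lay in 𝕁(𝔸(J))(U) but
-- not in J(U), it would lie in 𝔸(J)(∁ U); the compatibility 𝔸(J) ◁ 𝕁(𝔸(J)) would then
-- give a point of ∁ U inside 𝕁(𝔸(J))(U) ⊆ U. Conversely, for a proposition P take the
-- interior operator J on Bool of the basic opens {false | P} and {false} ∪ {true | P}.
-- Here 𝔸(J) is the closure, and 𝕁(𝔸(J)) keeps false in every U containing it, whereas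
-- false lies in the J-interior of {false} exactly when one of the two basic opens is
-- included in {false}, i.e. when P or ¬ P.
module Submission where

open import Defs
open import Axiom.DoubleNegationElimination using (em⇒dne)
open import Data.Bool using (Bool; true; false)
open import Data.Empty using (⊥; ⊥-elim)
open import Data.Product using (Σ; _×_; _,_; proj₁; proj₂)
open import Data.Sum using (_⊎_; inj₁; inj₂)
open import Data.Unit using (⊤; tt)
open import Function.Base using (case_of_)
open import Function.Bundles using (_⇔_; mk⇔)
open import Relation.Nullary using (¬_)
open import Relation.Nullary.Decidable using (fromSum)
open import Relation.Nullary.Negation using (Stable)
open import Relation.Binary.PropositionalEquality using (_≡_; refl)

lem⇒stable : LEM → ∀ {X : Set} → Stable X
lem⇒stable lem = em⇒dne (λ {P} → fromSum (lem P))

∁ : {S : Set} → Pow S → Pow S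
∁ U a = ¬ U a

module Basis {I S : Set} (B : I → Pow S) where

  interior : Op S
  interior U a = Σ I λ i → a ∈ B i × B i ⊆ U

  closure : Op S
  closure W a = ∀ i → a ∈ B i → W ≬ B i

  interior-deflationary : ∀ U → interior U ⊆ U
  interior-deflationary U a (i , a∈Bi , Bi⊆U) = Bi⊆U a a∈Bi

  interior-isReduction : IsReduction interior
  interior-isReduction =
      (λ U V U⊆V a → λ { (i , a∈Bi , Bi⊆U) → i , a∈Bi , λ b b∈Bi → U⊆V b (Bi⊆U b b∈Bi) })
    , (λ U → interior-deflationary (interior U)
           , λ a → λ { (i , a∈Bi , Bi⊆U) → i , a∈Bi , λ b b∈Bi → i , b∈Bi , Bi⊆U })
    , interior-deflationary

  closure-inflationary : ∀ U → U ⊆ closure U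
  closure-inflationary U a a∈U i a∈Bi = a , a∈U , a∈Bi

  closure-isSaturation : IsSaturation closure
  closure-isSaturation =
      (λ U V U⊆V a a∈U̅ i a∈Bi → let (b , b∈U , b∈Bi) = a∈U̅ i a∈Bi in b , U⊆V b b∈U , b∈Bi)
    , (λ U → (λ a a∈U̅̅ i a∈Bi → let (b , b∈U̅ , b∈Bi) = a∈U̅̅ i a∈Bi in b∈U̅ i b∈Bi)
           , closure-inflationary (closure U))
    , closure-inflationary

  closure◁interior : closure ◁ interior
  closure◁interior U V (a , a∈U̅ , (i , a∈Bi , Bi⊆V)) =
    let (b , b∈U , b∈Bi) = a∈U̅ i a∈Bi in b , b∈U , (i , b∈Bi , Bi⊆V)

  closure-greatest : ∀ A → A ◁ interior → A ≤ₒ closure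
  closure-greatest A A◁int U a a∈AU i a∈Bi
    with A◁int U (B i) (a , a∈AU , (i , a∈Bi , λ _ b∈Bi → b∈Bi))
  ... | (b , b∈U , (j , b∈Bj , Bj⊆Bi)) = b , b∈U , Bj⊆Bi b b∈Bj

  closure-is𝔸 : Is𝔸 interior closure
  closure-is𝔸 = closure-isSaturation , closure◁interior , λ A _ → closure-greatest A

module Counterexample (P : Set) where

  basic : Bool → Pow Bool
  basic false false = P
  basic false true  = ⊥
  basic true  false = ⊤
  basic true  true  = P

  open Basis basic

  core : Op Bool
  core U false = U false
  core U true  = U true × P × U false

  core-isReduction : IsReduction core
  core-isReduction = monotone , (λ U → idem U , idem⁻¹ U) , deflationary
    where
    monotone : Monotone core
    monotone U V U⊆V false f∈U             = U⊆V false f∈U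
    monotone U V U⊆V true  (t∈U , p , f∈U) = U⊆V true t∈U , p , U⊆V false f∈U

    deflationary : ∀ U → core U ⊆ U
    deflationary U false f∈U           = f∈U
    deflationary U true  (t∈U , _ , _) = t∈U

    idem : ∀ U → core (core U) ⊆ core U
    idem U = deflationary (core U)

    idem⁻¹ : ∀ U → core U ⊆ core (core U)
    idem⁻¹ U false f∈U             = f∈U
    idem⁻¹ U true  (t∈U , p , f∈U) = (t∈U , p , f∈U) , p , f∈U

  false∈closure⇒false∈ : ∀ W → false ∈ closure W → false ∈ W
  false∈closure⇒false∈ W f∈W̅ with f∈W̅ true tt
  ... | (false , f∈W , _) = f∈W
  ... | (true  , _   , p) with f∈W̅ false p
  ...   | (false , f∈W , _) = f∈W

  true∈closure : ∀ W → (P → false ∈ W) → true ∈ closure W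
  true∈closure W f∈W true p = false , f∈W p , tt

  closure◁core : closure ◁ core
  closure◁core U V (false , f∈U̅ , f∈V) = false , false∈closure⇒false∈ U f∈U̅ , f∈V
  closure◁core U V (true  , t∈U̅ , (t∈V , p , f∈V)) with t∈U̅ true p
  ... | (false , f∈U , _) = false , f∈U , f∈V
  ... | (true  , t∈U , _) = true  , t∈U , (t∈V , p , f∈V)

  core-greatest : ∀ J → IsReduction J → closure ◁ J → J ≤ₒ core
  core-greatest J (_ , _ , J-deflationary) W̅◁J U false f∈JU = J-deflationary U false f∈JU
  core-greatest J (_ , _ , J-deflationary) W̅◁J U true  t∈JU =
    J-deflationary U true t∈JU , p , J-deflationary U false f∈JU
    where
    meets : ∀ W → (P → false ∈ W) → W ≬ J U
    meets W f∈W = W̅◁J W U (true , true∈closure W f∈W , t∈JU)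

    p : P
    p with meets (λ _ → P) (λ p → p)
    ... | (_ , p , _) = p

    f∈JU : false ∈ J U
    f∈JU with meets (_≡ false) (λ _ → refl)
    ... | (false , refl , f∈JU) = f∈JU

  core-is𝕁 : Is𝕁 closure core
  core-is𝕁 = core-isReduction , closure◁core , core-greatest

  decide : core ≤ₒ interior → P ⊎ ¬ P
  decide core≤int with core≤int (_≡ false) false refl
  ... | (false , p , _)                = inj₁ p
  ... | (true  , _ , basic-true⊆false) = inj₂ λ p → case basic-true⊆false true p of λ ()

statementI⇒lem : StatementI → LEM
statementI⇒lem statementI P =
  decide (proj₁ (statementI Bool interior interior-isReduction closure closure-is𝔸 core core-is𝕁))
  where
  open Counterexample P
  open Basis basic

module Classical (lem : LEM) {S : Set} (J : Op S) (J-isReduction : IsReduction J) where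

  J-monotone : Monotone J
  J-monotone = proj₁ J-isReduction

  J-deflationary : ∀ U → J U ⊆ U
  J-deflationary = proj₂ (proj₂ J-isReduction)

  J-idempotent⁻¹ : ∀ U → J U ⊆ J (J U)
  J-idempotent⁻¹ U = proj₂ (proj₁ (proj₂ J-isReduction) U)

  dual : Op S
  dual U = ∁ (J (∁ U))

  dual-isSaturation : IsSaturation dual
  dual-isSaturation = monotone , (λ U → idem U , inflationary (dual U)) , inflationary
    where
    monotone : Monotone dual
    monotone U V U⊆V a a∉J∁U a∈J∁V =
      a∉J∁U (J-monotone (∁ V) (∁ U) (λ b b∉V b∈U → b∉V (U⊆V b b∈U)) a a∈J∁V)

    inflationary : ∀ U → U ⊆ dual U
    inflationary U a a∈U a∈J∁U = J-deflationary (∁ U) a a∈J∁U a∈U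

    idem : ∀ U → dual (dual U) ⊆ dual U
    idem U a a∉J∁dU a∈J∁U =
      a∉J∁dU (J-monotone (J (∁ U)) (∁ (dual U)) (λ b b∈J∁U b∉J∁U → b∉J∁U b∈J∁U) a
               (J-idempotent⁻¹ (∁ U) a a∈J∁U))

  dual◁J : dual ◁ J
  dual◁J U V (a , a∉J∁JV , a∈JV) with lem (U ≬ J V)
  ... | inj₁ U≬JV = U≬JV
  ... | inj₂ ¬U≬JV = ⊥-elim (a∉J∁JV (J-monotone (J V) (∁ U)
                        (λ b b∈JV b∈U → ¬U≬JV (b , b∈U , b∈JV)) a
                        (J-idempotent⁻¹ V a a∈JV)))

  𝕁[𝔸[J]]≐J : ∀ A → Is𝔸 J A → ∀ J' → Is𝕁 A J' → J' ≐ J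
  𝕁[𝔸[J]]≐J A (_ , A◁J , A-greatest) J' ((_ , _ , J'-deflationary) , A◁J' , J'-greatest) =
    J'≤J , J'-greatest J J-isReduction A◁J
    where
    outside-J⇒in-A∁ : ∀ U a → ¬ J U a → a ∈ A (∁ U)
    outside-J⇒in-A∁ U a a∉JU = A-greatest dual dual-isSaturation dual◁J (∁ U) a
      (λ a∈J∁∁U → a∉JU (J-monotone (∁ (∁ U)) U (λ _ → lem⇒stable lem) a a∈J∁∁U))

    J'≤J : J' ≤ₒ J
    J'≤J U a a∈J'U with lem (J U a)
    ... | inj₁ a∈JU = a∈JU
    ... | inj₂ a∉JU with A◁J' (∁ U) U (a , outside-J⇒in-A∁ U a a∉JU , a∈J'U)
    ...   | (b , b∉U , b∈J'U) = ⊥-elim (b∉U (J'-deflationary U b b∈J'U))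

lem⇒statementI : LEM → StatementI
lem⇒statementI lem S J J-isReduction = Classical.𝕁[𝔸[J]]≐J lem J J-isReduction

proposition4p7 : StatementI ⇔ LEM
proposition4p7 = mk⇔ statementI⇒lem lem⇒statementI
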